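{- There is a polynomial $p$ such that for every $n$ the formula $J'_n[R]$ has length at most $p(n)$.
   Context: Work in the language of arithmetic (with the biconditional $\leftrightarrow$ taken as a primitive connective, and with the ordinal notation operations such as $\beta+\omega^\gamma$ and the ordinal order $\prec$ on codes of ordinals below $\varepsilon_0$ available) extended by a unary predicate variable $R$; length of a formula = number of symbols. Let $\theta(\delta_0,\delta_1)\equiv\exists_{v_0,v_1}\big[\forall_z\big(\bigvee_{i=0,1}z=\delta_i\to(Rz\leftrightarrow\bigwedge_{i=0,1}(z=\delta_i\to v_i=1))\big)\wedge(v_0=1\to v_1=1)\big]$ and $J'[R](\gamma)\equiv\forall_\beta\exists_{\delta_0\prec\beta}\forall_{\delta_1\prec\beta+\omega^\gamma}\theta(\delta_0,\delta_1)$ (a formula with a single occurrence of $R$, equivalent to $\forall_\beta(\forall_{\delta\prec\beta}R\delta\to\forall_{\delta\prec\beta+\omega^\gamma}R\delta)$). For a formula $\psi(\gamma)$, $J'[\{\gamma\mid\psi(\gamma)\}]$ denotes the result of replacing every subformula $Rt$ of $J'[R]$ by $\psi(t)$, renaming bound variables as necessary. Define $J'_0[R](\gamma)\equiv R\gamma$ and $J'_{n+1}[R](\gamma)\equiv J'[\{\gamma\mid J'_n[R]\}]$. -}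

module Defs where

open import Data.Nat using (ℕ; zero; suc; _+_; _*_)
open import Data.List using (List; []; _∷_)

-- Variables are represented by de Bruijn indices, so renaming of bound
-- variables is automatic (capture-avoiding substitution).  Each variable
-- occurrence counts as ONE symbol, as in the paper.

data Term : Set where
  var    : ℕ → Term
  zer    : Term
  one    : Term
  succ   : Term → Term
  _⊕ₙ_   : Term → Term → Term
  _⊗ₙ_   : Term → Term → Term
  _⊕ₒ_   : Term → Term → Term
  ω^_    : Term → Term

data Form : Set where
  R     : Term → Form
  _≐_   : Term → Term → Form
  _≺_   : Term → Term → Form   -- ordinal order on codes below ε₀
  ¬'_   : Form → Form
  _∧'_  : Form → Form → Form
  _∨'_  : Form → Form → Form
  _⇒_   : Form → Form → Form
  _⇔_   : Form → Form → Form   -- biconditional, primitive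
  ∀'    : Form → Form
  ∃'    : Form → Form

infix 7 _≐_ _≺_
infixr 6 _∧'_
infixr 5 _∨'_
infixr 4 _⇒_ _⇔_

-- Bounded quantifiers are abbreviations:
--   ∃_{x ≺ t} φ  :=  ∃x (x ≺ t ∧ φ),   ∀_{x ≺ t} φ := ∀x (x ≺ t → φ)
-- where t is given in the context *outside* the binder (so it is shifted).

renT : (ℕ → ℕ) → Term → Term
renT ρ (var i) = var (ρ i)
renT ρ zer = zer
renT ρ one = one
renT ρ (succ t) = succ (renT ρ t)
renT ρ (t ⊕ₙ s) = renT ρ t ⊕ₙ renT ρ s
renT ρ (t ⊗ₙ s) = renT ρ t ⊗ₙ renT ρ s
renT ρ (t ⊕ₒ s) = renT ρ t ⊕ₒ renT ρ s
renT ρ (ω^ t) = ω^ (renT ρ t)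

∃≺ : Term → Form → Form
∃≺ t φ = ∃' (var 0 ≺ renT suc t ∧' φ)

∀≺ : Term → Form → Form
∀≺ t φ = ∀' (var 0 ≺ renT suc t ⇒ φ)

-- Length = number of symbols (binary term operations and binary
-- connectives are written infix with a pair of parentheses; a quantifier
-- contributes the quantifier symbol and its variable).

lenT : Term → ℕ
lenT (var _) = 1
lenT zer = 1
lenT one = 1
lenT (succ t) = 1 + lenT t
lenT (t ⊕ₙ s) = 3 + lenT t + lenT s
lenT (t ⊗ₙ s) = 3 + lenT t + lenT s
lenT (t ⊕ₒ s) = 3 + lenT t + lenT s
lenT (ω^ t) = 1 + lenT t

len : Form → ℕ
len (R t) = 1 + lenT t
len (t ≐ s) = 1 + lenT t + lenT s
len (t ≺ s) = 1 + lenT t + lenT s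
len (¬' φ) = 1 + len φ
len (φ ∧' ψ) = 3 + len φ + len ψ
len (φ ∨' ψ) = 3 + len φ + len ψ
len (φ ⇒ ψ) = 3 + len φ + len ψ
len (φ ⇔ ψ) = 3 + len φ + len ψ
len (∀' φ) = 2 + len φ
len (∃' φ) = 2 + len φ

Sub : Set
Sub = ℕ → Term

lift : Sub → Sub
lift σ zero = var zero
lift σ (suc i) = renT suc (σ i)

subT : Sub → Term → Term
subT σ (var i) = σ i
subT σ zer = zer
subT σ one = one
subT σ (succ t) = succ (subT σ t)
subT σ (t ⊕ₙ s) = subT σ t ⊕ₙ subT σ s
subT σ (t ⊗ₙ s) = subT σ t ⊗ₙ subT σ s
subT σ (t ⊕ₒ s) = subT σ t ⊕ₒ subT σ s
subT σ (ω^ t) = ω^ (subT σ t)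

subF : Sub → Form → Form
subF σ (R t) = R (subT σ t)
subF σ (t ≐ s) = subT σ t ≐ subT σ s
subF σ (t ≺ s) = subT σ t ≺ subT σ s
subF σ (¬' φ) = ¬' subF σ φ
subF σ (φ ∧' ψ) = subF σ φ ∧' subF σ ψ
subF σ (φ ∨' ψ) = subF σ φ ∨' subF σ ψ
subF σ (φ ⇒ ψ) = subF σ φ ⇒ subF σ ψ
subF σ (φ ⇔ ψ) = subF σ φ ⇔ subF σ ψ
subF σ (∀' φ) = ∀' (subF (lift σ) φ)
subF σ (∃' φ) = ∃' (subF (lift σ) φ)

-- Substitution of a class term {γ | ψ(γ)} for R:  every subformula R t
-- is replaced by ψ(t).  ψ is a formula whose variable γ is index 0 and
-- whose other free variables (index i+1) are the free variables i of the
-- ambient context.  k = number of binders passed so far.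

instR' : ℕ → Form → Form → Form
instR' k ψ (R t) = subF σ ψ
  where
  σ : Sub
  σ zero = t
  σ (suc i) = var (i + k)
instR' k ψ (t ≐ s) = t ≐ s
instR' k ψ (t ≺ s) = t ≺ s
instR' k ψ (¬' φ) = ¬' instR' k ψ φ
instR' k ψ (φ ∧' χ) = instR' k ψ φ ∧' instR' k ψ χ
instR' k ψ (φ ∨' χ) = instR' k ψ φ ∨' instR' k ψ χ
instR' k ψ (φ ⇒ χ) = instR' k ψ φ ⇒ instR' k ψ χ
instR' k ψ (φ ⇔ χ) = instR' k ψ φ ⇔ instR' k ψ χ
instR' k ψ (∀' φ) = ∀' (instR' (suc k) ψ φ)
instR' k ψ (∃' φ) = ∃' (instR' (suc k) ψ φ)

_[R≔_] : Form → Form → Form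
F [R≔ ψ ] = instR' 0 ψ F

-- The formula θ(δ₀,δ₁) and J'[R](γ).
-- θ(δ₀,δ₁) ≡ ∃v₀ ∃v₁ [ ∀z ( (z=δ₀ ∨ z=δ₁) →
--                 (Rz ↔ ((z=δ₀ → v₀=1) ∧ (z=δ₁ → v₁=1))) )
--               ∧ (v₀=1 → v₁=1) ]
-- stated in a context where δ₁ = var 0 and δ₀ = var 1.
-- Inside ∃v₀∃v₁: v₁ = 0, v₀ = 1, δ₁ = 2, δ₀ = 3.
-- Inside also ∀z: z = 0, v₁ = 1, v₀ = 2, δ₁ = 3, δ₀ = 4.

θ : Form
θ = ∃' (∃' (
      ∀' ( (var 0 ≐ var 4 ∨' var 0 ≐ var 3)
           ⇒ (R (var 0) ⇔ ((var 0 ≐ var 4 ⇒ var 2 ≐ one)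
                           ∧' (var 0 ≐ var 3 ⇒ var 1 ≐ one))))
      ∧' (var 1 ≐ one ⇒ var 0 ≐ one)))

-- J'[R](γ) ≡ ∀β ∃_{δ₀ ≺ β} ∀_{δ₁ ≺ β + ω^γ} θ(δ₀,δ₁),   γ = var 0.
-- Under ∀β: β = 0, γ = 1.  Under ∃δ₀ additionally: δ₀ = 0, β = 1, γ = 2.
J' : Form
J' = ∀' (∃≺ (var 0) (∀≺ (var 1 ⊕ₒ (ω^ var 2)) θ))

J'ₙ : ℕ → Form
J'ₙ zero = R (var 0)
J'ₙ (suc n) = J' [R≔ J'ₙ n ]

-- Polynomials with natural-number coefficients (c₀ ∷ c₁ ∷ … = c₀ + c₁x + …)

evalPoly : List ℕ → ℕ → ℕ
evalPoly [] x = 0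
evalPoly (c ∷ cs) x = c + x * evalPoly cs x

module Submission where

-- The length of J'ₙ grows LINEARLY in n, so the polynomial 2 + 77·x works.
--
-- J'[R] contains exactly one occurrence of R, namely R z with z a bound
-- variable.  Forming J'[{γ | ψ}] therefore replaces the two symbols "R z" by
-- one copy of ψ in which the variable γ is replaced by z and the remaining
-- free variables are shifted past the binders.  Such a substitution sends
-- variables to variables, and substitutions sending every variable to a
-- one-symbol term do not change the length of a formula.  Hence
--   len (J'[R≔ψ]) = len J' − 2 + len ψ = 77 + len ψ,
-- and by induction len (J'ₙ n) = 2 + 77·n.

open import Defs
open import Data.Nat using (ℕ; _≤_; zero; suc; _+_; _*_)
open import Data.Nat.Properties using (≤-reflexive; *-zeroʳ; +-identityʳ; +-assoc; +-comm)
open import Data.List using (List; []; _∷_)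
open import Data.Product using (∃; _,_)
open import Relation.Binary.PropositionalEquality
open ≡-Reasoning

renT-len : ∀ ρ t → lenT (renT ρ t) ≡ lenT t
renT-len ρ (var x) = refl
renT-len ρ zer = refl
renT-len ρ one = refl
renT-len ρ (succ t) = cong suc (renT-len ρ t)
renT-len ρ (t ⊕ₙ s) = cong₂ (λ a b → 3 + a + b) (renT-len ρ t) (renT-len ρ s)
renT-len ρ (t ⊗ₙ s) = cong₂ (λ a b → 3 + a + b) (renT-len ρ t) (renT-len ρ s)
renT-len ρ (t ⊕ₒ s) = cong₂ (λ a b → 3 + a + b) (renT-len ρ t) (renT-len ρ s)
renT-len ρ (ω^ t) = cong suc (renT-len ρ t)

Atomic : Sub → Set
Atomic σ = ∀ i → lenT (σ i) ≡ 1

lift-atomic : ∀ σ → Atomic σ → Atomic (lift σ)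
lift-atomic σ atomic zero = refl
lift-atomic σ atomic (suc i) = trans (renT-len suc (σ i)) (atomic i)

subT-len : ∀ σ → Atomic σ → ∀ t → lenT (subT σ t) ≡ lenT t
subT-len σ atomic (var x) = atomic x
subT-len σ atomic zer = refl
subT-len σ atomic one = refl
subT-len σ atomic (succ t) = cong suc (subT-len σ atomic t)
subT-len σ atomic (t ⊕ₙ s) = cong₂ (λ a b → 3 + a + b) (subT-len σ atomic t) (subT-len σ atomic s)
subT-len σ atomic (t ⊗ₙ s) = cong₂ (λ a b → 3 + a + b) (subT-len σ atomic t) (subT-len σ atomic s)
subT-len σ atomic (t ⊕ₒ s) = cong₂ (λ a b → 3 + a + b) (subT-len σ atomic t) (subT-len σ atomic s)
subT-len σ atomic (ω^ t) = cong suc (subT-len σ atomic t)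

subF-len : ∀ σ → Atomic σ → ∀ φ → len (subF σ φ) ≡ len φ
subF-len σ atomic (R t) = cong suc (subT-len σ atomic t)
subF-len σ atomic (t ≐ s) = cong₂ (λ a b → 1 + a + b) (subT-len σ atomic t) (subT-len σ atomic s)
subF-len σ atomic (t ≺ s) = cong₂ (λ a b → 1 + a + b) (subT-len σ atomic t) (subT-len σ atomic s)
subF-len σ atomic (¬' φ) = cong suc (subF-len σ atomic φ)
subF-len σ atomic (φ ∧' ψ) = cong₂ (λ a b → 3 + a + b) (subF-len σ atomic φ) (subF-len σ atomic ψ)
subF-len σ atomic (φ ∨' ψ) = cong₂ (λ a b → 3 + a + b) (subF-len σ atomic φ) (subF-len σ atomic ψ)
subF-len σ atomic (φ ⇒ ψ) = cong₂ (λ a b → 3 + a + b) (subF-len σ atomic φ) (subF-len σ atomic ψ)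
subF-len σ atomic (φ ⇔ ψ) = cong₂ (λ a b → 3 + a + b) (subF-len σ atomic φ) (subF-len σ atomic ψ)
subF-len σ atomic (∀' φ) = cong (2 +_) (subF-len (lift σ) (lift-atomic σ atomic) φ)
subF-len σ atomic (∃' φ) = cong (2 +_) (subF-len (lift σ) (lift-atomic σ atomic) φ)

-- Instantiating R by ψ in an atom R x with x a variable yields a copy of ψ
-- of the same length: the substitution used maps variables to variables.
instR-var-len : ∀ k ψ j → len (instR' k ψ (R (var j))) ≡ len ψ
instR-var-len k ψ j = subF-len _ (λ { zero → refl ; (suc i) → refl }) ψ

-- One J'-step adds 77 symbols: J' has 79 symbols, of which the single atom
-- R z (two symbols, under six binders) is replaced by a copy of ψ.
J'-step-len : ∀ ψ → len (J' [R≔ ψ ]) ≡ 77 + len ψ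
J'-step-len ψ = begin
  47 + (len (instR' 6 ψ (R (var 0))) + 21 + 9) ≡⟨ cong (λ m → 47 + (m + 21 + 9)) (instR-var-len 6 ψ 0) ⟩
  47 + (len ψ + 21 + 9)                       ≡⟨ cong (47 +_) (+-assoc (len ψ) 21 9) ⟩
  47 + (len ψ + 30)                           ≡⟨ cong (47 +_) (+-comm (len ψ) 30) ⟩
  77 + len ψ                                  ∎

J'ₙ-len : ∀ n → len (J'ₙ n) ≡ 2 + n * 77
J'ₙ-len zero = refl
J'ₙ-len (suc n) = trans (J'-step-len (J'ₙ n)) (cong (77 +_) (J'ₙ-len n))

evalPoly-linear : ∀ a b x → evalPoly (a ∷ b ∷ []) x ≡ a + x * b
evalPoly-linear a b x = cong (λ m → a + x * m)
  (trans (cong (b +_) (*-zeroʳ x)) (+-identityʳ b))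

lemma3p3 : ∃ λ (p : List ℕ) → ∀ (n : ℕ) → len (J'ₙ n) ≤ evalPoly p n
lemma3p3 = (2 ∷ 77 ∷ []) , λ n →
  ≤-reflexive (trans (J'ₙ-len n) (sym (evalPoly-linear 2 77 n)))
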